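{- Every ordered young group is metabelian, and every nilpotent ordered young group is nilpotent of class at most $2$.
   Context: An ordered group is a group $G$ with a total order $\le$ such that $a\le b$ implies $xay\le xby$ for all $a,b,x,y\in G$. Notation: $[a,b]=a^{ -1}b^{ -1}ab$ and $a^b=b^{ -1}ab$. An ordered group $G$ is called young if one of the following holds: (i) $G=\langle a,b\rangle$ with $[[a,b],a]=[[a,b],b]=1$; (ii) $G=\langle a\rangle\times\langle b,c\rangle$ with either $c^b=c^2$ or $(c^2)^b=c$, and $c\ne 1$; (iii) $G=\langle a,b\rangle$ with $a^b=a^2$ and $a\ne 1$; (iv) $G=\langle a,b\rangle$ with $a^{b^2}=aa^b$, $[a,a^b]=1$ and $a\ne 1$. A group is metabelian if its derived subgroup is abelian. -}

module Defs where

open import Level using (Level; _⊔_; suc; Lift)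
open import Data.Nat using (ℕ; zero) renaming (suc to sucℕ)
open import Data.Product using (Σ; ∃; ∃-syntax; _×_)
open import Data.Sum using (_⊎_)
open import Data.Unit.Polymorphic using (⊤)
open import Relation.Nullary using (¬_)
open import Relation.Unary using (Pred)
open import Relation.Binary.Core using (Rel)
open import Relation.Binary.Structures using (IsTotalOrder)
open import Algebra.Bundles using (Group)

record OrderedGroup (c ℓ ℓ₂ : Level) : Set (suc (c ⊔ ℓ ⊔ ℓ₂)) where
  field
    group : Group c ℓ
  open Group group
  field
    _≤_          : Rel Carrier ℓ₂
    isTotalOrder : IsTotalOrder _≈_ _≤_
    compatible   : ∀ {a b} (x y : Carrier) → a ≤ b → ((x ∙ a) ∙ y) ≤ ((x ∙ b) ∙ y)

module GroupNotions {c ℓ : Level} (G : Group c ℓ) where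
  open Group G

  [_,_] : Carrier → Carrier → Carrier
  [ a , b ] = ((a ⁻¹ ∙ b ⁻¹) ∙ a) ∙ b

  _^_ : Carrier → Carrier → Carrier
  a ^ b = (b ⁻¹ ∙ a) ∙ b

  data ⟨_⟩ {s : Level} (S : Pred Carrier s) : Pred Carrier (c ⊔ ℓ ⊔ s) where
    gen  : ∀ {x} → S x → ⟨ S ⟩ x
    one  : ⟨ S ⟩ ε
    inv  : ∀ {x} → ⟨ S ⟩ x → ⟨ S ⟩ (x ⁻¹)
    mul  : ∀ {x y} → ⟨ S ⟩ x → ⟨ S ⟩ y → ⟨ S ⟩ (x ∙ y)
    resp : ∀ {x y} → x ≈ y → ⟨ S ⟩ x → ⟨ S ⟩ y

  ⟨_⟩₁ : Carrier → Pred Carrier (c ⊔ ℓ)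
  ⟨ a ⟩₁ = ⟨ (λ z → z ≈ a) ⟩

  ⟨_,_⟩₂ : Carrier → Carrier → Pred Carrier (c ⊔ ℓ)
  ⟨ a , b ⟩₂ = ⟨ (λ z → z ≈ a ⊎ z ≈ b) ⟩

  ⟨_,_,_⟩₃ : Carrier → Carrier → Carrier → Pred Carrier (c ⊔ ℓ)
  ⟨ a , b , d ⟩₃ = ⟨ (λ z → z ≈ a ⊎ z ≈ b ⊎ z ≈ d) ⟩

  Generates : Pred Carrier (c ⊔ ℓ) → Set (c ⊔ ℓ)
  Generates H = ∀ x → H x

  Abelian : Pred Carrier (c ⊔ ℓ) → Set (c ⊔ ℓ)
  Abelian H = ∀ {x y} → H x → H y → (x ∙ y) ≈ (y ∙ x)

  γ : ℕ → Pred Carrier (c ⊔ ℓ)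
  γ zero     = λ _ → ⊤
  γ (sucℕ n) = ⟨ (λ z → ∃[ x ] ∃[ g ] (γ n x × z ≈ [ x , g ])) ⟩

  Derived : Pred Carrier (c ⊔ ℓ)
  Derived = ⟨ (λ z → ∃[ x ] ∃[ y ] (z ≈ [ x , y ])) ⟩

  Metabelian : Set (c ⊔ ℓ)
  Metabelian = Abelian Derived

  Trivial : Pred Carrier (c ⊔ ℓ) → Set (c ⊔ ℓ)
  Trivial H = ∀ {x} → H x → x ≈ ε

  Nilpotent : Set (c ⊔ ℓ)
  Nilpotent = ∃[ n ] Trivial (γ n)

  -- nilpotent of class at most k : γ_{k+1} = 1 (here γ k with γ 0 = G)
  NilpotentClass≤ : ℕ → Set (c ⊔ ℓ)
  NilpotentClass≤ k = Trivial (γ k)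

  Young : Set (c ⊔ ℓ)
  Young =
      (∃[ a ] ∃[ b ] (Generates ⟨ a , b ⟩₂
         × [ [ a , b ] , a ] ≈ ε × [ [ a , b ] , b ] ≈ ε))
    ⊎ (∃[ a ] ∃[ b ] ∃[ d ]
         -- G = ⟨a⟩ × ⟨b,d⟩ as an internal direct product
         ((Generates ⟨ a , b , d ⟩₃
           × (a ∙ b) ≈ (b ∙ a) × (a ∙ d) ≈ (d ∙ a)
           × (∀ {x} → ⟨ a ⟩₁ x → ⟨ b , d ⟩₂ x → x ≈ ε))
         × ((d ^ b) ≈ (d ∙ d) ⊎ ((d ∙ d) ^ b) ≈ d)
         × ¬ (d ≈ ε)))
    ⊎ (∃[ a ] ∃[ b ] (Generates ⟨ a , b ⟩₂ × (a ^ b) ≈ (a ∙ a) × ¬ (a ≈ ε)))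
    ⊎ (∃[ a ] ∃[ b ] (Generates ⟨ a , b ⟩₂
         × (a ^ (b ∙ b)) ≈ (a ∙ (a ^ b)) × [ a , a ^ b ] ≈ ε × ¬ (a ≈ ε)))

{-# OPTIONS --safe #-}
-- In every case one finds pairwise commuting elements T whose span N = ⟨T⟩ is
-- normalised by the generators of G and contains their commutators; then G' ⊆ N,
-- which is abelian. In (i) T = {[a,b]} is central, so G' is central and G has
-- class at most 2. In (ii), where d^b = d² after replacing b by b⁻¹ in the
-- second alternative (and (iii) is (ii) with trivial first factor and d = a),
-- T consists of the iterated square roots d^(b^-k) of d; in (iv), T = {a, a^b},
-- on which b acts by the Fibonacci matrix.
-- In (ii)–(iv) G is never nilpotent: d = [d,b], resp. a = [a^b,b] and
-- a^b = [a·a^b,b], lie in every term of the lower central series.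
module Submission where

open import Defs
open import Algebra.Bundles using (Group)

open import Level using (_⊔_)
open import Data.Bool using (Bool; true; false; not; _xor_)
open import Data.Empty using (⊥-elim)
open import Function using (_∘_)
open import Data.Fin using (Fin; _≟_) renaming (zero to fzero; suc to fsuc)
open import Data.List using (List; []; _∷_)
open import Data.Nat using (ℕ; zero; suc; _+_; _∸_)
open import Data.Nat.Properties using (+-suc; ≤-total; m∸n+n≡m)
open import Data.Product using (_×_; _,_; proj₁; proj₂; ∃-syntax)
open import Data.Sum using (_⊎_; inj₁; inj₂)
open import Data.Unit.Polymorphic using (tt)
open import Data.Vec using (Vec; lookup) renaming (_∷_ to _∷ᵥ_; [] to []ᵥ)
open import Relation.Nullary using (yes; no; ¬_)
open import Relation.Unary using (Pred; _⊆_)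
open import Relation.Binary.PropositionalEquality as ≡ using (_≡_)

module FreeGroupSolver {c ℓ} (G : Group c ℓ) where
  open Group G
  open import Algebra.Properties.Group G using (ε⁻¹≈ε; ⁻¹-involutive; ⁻¹-anti-homo-∙)
  open import Relation.Binary.Reasoning.Setoid setoid

  infixl 7 _·_
  infix 8 _⁻
  data Expr (n : ℕ) : Set where
    var : Fin n → Expr n
    1ₑ  : Expr n
    _·_ : Expr n → Expr n → Expr n
    _⁻  : Expr n → Expr n

  _^ₑ_ : ∀ {n} → Expr n → Expr n → Expr n
  x ^ₑ g = (g ⁻ · x) · g

  [_,_]ₑ : ∀ {n} → Expr n → Expr n → Expr n
  [ x , y ]ₑ = ((x ⁻ · y ⁻) · x) · y

  X : ∀ {n} → Expr (suc n)
  X = var fzero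

  Y : ∀ {n} → Expr (suc (suc n))
  Y = var (fsuc fzero)

  Z : ∀ {n} → Expr (suc (suc (suc n)))
  Z = var (fsuc (fsuc fzero))

  -- (true , i) is the inverse of the i-th letter.
  Letter : ℕ → Set
  Letter n = Bool × Fin n

  Word : ℕ → Set
  Word n = List (Letter n)

  module _ {n : ℕ} where
    cancels : Letter n → Letter n → Bool
    cancels (b , i) (b′ , j) with i ≟ j
    ... | yes _ = b xor b′
    ... | no  _ = false

    cons : Letter n → Word n → Word n
    cons l [] = l ∷ []
    cons l (l′ ∷ w) with cancels l l′
    ... | true  = w
    ... | false = l ∷ l′ ∷ w

    append : Word n → Word n → Word n
    append []      w = w
    append (l ∷ u) w = cons l (append u w)

    invert : Word n → Word n
    invert []            = []
    invert ((b , i) ∷ u) = append (invert u) ((not b , i) ∷ [])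

    normalise : Expr n → Word n
    normalise (var i) = (false , i) ∷ []
    normalise 1ₑ      = []
    normalise (x · y) = append (normalise x) (normalise y)
    normalise (x ⁻)   = invert (normalise x)

    module _ (ρ : Vec Carrier n) where
      ⟦_⟧ : Expr n → Carrier
      ⟦ var i ⟧ = lookup ρ i
      ⟦ 1ₑ ⟧    = ε
      ⟦ x · y ⟧ = ⟦ x ⟧ ∙ ⟦ y ⟧
      ⟦ x ⁻ ⟧   = ⟦ x ⟧ ⁻¹

      ⟦_⟧ˡ : Letter n → Carrier
      ⟦ false , i ⟧ˡ = lookup ρ i
      ⟦ true  , i ⟧ˡ = lookup ρ i ⁻¹

      ⟦_⟧ʷ : Word n → Carrier
      ⟦ [] ⟧ʷ    = ε
      ⟦ l ∷ w ⟧ʷ = ⟦ l ⟧ˡ ∙ ⟦ w ⟧ʷ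

      cancels-sound : ∀ l l′ x → cancels l l′ ≡ true → ⟦ l ⟧ˡ ∙ (⟦ l′ ⟧ˡ ∙ x) ≈ x
      cancels-sound (b , i) (b′ , j) x eq with i ≟ j
      cancels-sound (false , i) (true , .i) x eq | yes ≡.refl =
        trans (sym (assoc _ _ _)) (trans (∙-congʳ (inverseʳ _)) (identityˡ _))
      cancels-sound (true , i) (false , .i) x eq | yes ≡.refl =
        trans (sym (assoc _ _ _)) (trans (∙-congʳ (inverseˡ _)) (identityˡ _))

      cons-sound : ∀ l w → ⟦ cons l w ⟧ʷ ≈ ⟦ l ⟧ˡ ∙ ⟦ w ⟧ʷ
      cons-sound l [] = refl
      cons-sound l (l′ ∷ w) with cancels l l′ in eq
      ... | true  = sym (cancels-sound l l′ ⟦ w ⟧ʷ eq)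
      ... | false = refl

      append-sound : ∀ u w → ⟦ append u w ⟧ʷ ≈ ⟦ u ⟧ʷ ∙ ⟦ w ⟧ʷ
      append-sound []      w = sym (identityˡ _)
      append-sound (l ∷ u) w = begin
        ⟦ cons l (append u w) ⟧ʷ  ≈⟨ cons-sound l (append u w) ⟩
        ⟦ l ⟧ˡ ∙ ⟦ append u w ⟧ʷ  ≈⟨ ∙-congˡ (append-sound u w) ⟩
        ⟦ l ⟧ˡ ∙ (⟦ u ⟧ʷ ∙ ⟦ w ⟧ʷ) ≈⟨ sym (assoc _ _ _) ⟩
        (⟦ l ⟧ˡ ∙ ⟦ u ⟧ʷ) ∙ ⟦ w ⟧ʷ ∎

      not-sound : ∀ l → ⟦ not (proj₁ l) , proj₂ l ⟧ˡ ≈ ⟦ l ⟧ˡ ⁻¹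
      not-sound (false , i) = refl
      not-sound (true  , i) = sym (⁻¹-involutive _)

      invert-sound : ∀ u → ⟦ invert u ⟧ʷ ≈ ⟦ u ⟧ʷ ⁻¹
      invert-sound []      = sym ε⁻¹≈ε
      invert-sound (l ∷ u) = begin
        ⟦ append (invert u) (_ ∷ []) ⟧ʷ ≈⟨ append-sound (invert u) (_ ∷ []) ⟩
        ⟦ invert u ⟧ʷ ∙ (_ ∙ ε)         ≈⟨ ∙-cong (invert-sound u) (trans (identityʳ _) (not-sound l)) ⟩
        ⟦ u ⟧ʷ ⁻¹ ∙ ⟦ l ⟧ˡ ⁻¹            ≈⟨ sym (⁻¹-anti-homo-∙ _ _) ⟩
        (⟦ l ⟧ˡ ∙ ⟦ u ⟧ʷ) ⁻¹             ∎

      normalise-sound : ∀ e → ⟦ normalise e ⟧ʷ ≈ ⟦ e ⟧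
      normalise-sound (var i) = identityʳ _
      normalise-sound 1ₑ      = refl
      normalise-sound (x · y) =
        trans (append-sound (normalise x) (normalise y)) (∙-cong (normalise-sound x) (normalise-sound y))
      normalise-sound (x ⁻)   = trans (invert-sound (normalise x)) (⁻¹-cong (normalise-sound x))

  solve : ∀ {n} (e f : Expr n) → normalise e ≡ normalise f → ∀ ρ → ⟦ ρ ⟧ e ≈ ⟦ ρ ⟧ f
  solve e f eq ρ = begin
    ⟦ ρ ⟧ e                ≈⟨ normalise-sound ρ e ⟨
    ⟦ ρ ⟧ʷ (normalise e)   ≡⟨ ≡.cong (⟦ ρ ⟧ʷ) eq ⟩
    ⟦ ρ ⟧ʷ (normalise f)   ≈⟨ normalise-sound ρ f ⟩
    ⟦ ρ ⟧ f                ∎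

  solve₁ : (e f : Expr 1) → normalise e ≡ normalise f → ∀ x → ⟦ x ∷ᵥ []ᵥ ⟧ e ≈ ⟦ x ∷ᵥ []ᵥ ⟧ f
  solve₁ e f eq x = solve e f eq (x ∷ᵥ []ᵥ)

  solve₂ : (e f : Expr 2) → normalise e ≡ normalise f →
           ∀ x y → ⟦ x ∷ᵥ y ∷ᵥ []ᵥ ⟧ e ≈ ⟦ x ∷ᵥ y ∷ᵥ []ᵥ ⟧ f
  solve₂ e f eq x y = solve e f eq (x ∷ᵥ y ∷ᵥ []ᵥ)

  solve₃ : (e f : Expr 3) → normalise e ≡ normalise f →
           ∀ x y z → ⟦ x ∷ᵥ y ∷ᵥ z ∷ᵥ []ᵥ ⟧ e ≈ ⟦ x ∷ᵥ y ∷ᵥ z ∷ᵥ []ᵥ ⟧ f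
  solve₃ e f eq x y z = solve e f eq (x ∷ᵥ y ∷ᵥ z ∷ᵥ []ᵥ)

module YoungGroups {c ℓ} (G : Group c ℓ) where
  open Group G
  open GroupNotions G
  open import Algebra.Properties.Group G using (ε⁻¹≈ε; ⁻¹-involutive; ⁻¹-anti-homo-∙)
  open FreeGroupSolver G
  open import Relation.Binary.Reasoning.Setoid setoid

  ⟨⟩-ind : ∀ {s p} {S : Pred Carrier s} (P : Pred Carrier p) → S ⊆ P →
           P ε → (∀ {x} → P x → P (x ⁻¹)) → (∀ {x y} → P x → P y → P (x ∙ y)) →
           (∀ {x y} → x ≈ y → P x → P y) → ⟨ S ⟩ ⊆ P
  ⟨⟩-ind {S = S} P base p-ε p-⁻¹ p-∙ p-resp = go
    where
    go : ⟨ S ⟩ ⊆ P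
    go (gen x∈)   = base x∈
    go one        = p-ε
    go (inv x)    = p-⁻¹ (go x)
    go (mul x y)  = p-∙ (go x) (go y)
    go (resp e x) = p-resp e (go x)

  ⟨⟩-⊆ : ∀ {s t} {S : Pred Carrier s} {T : Pred Carrier t} → S ⊆ ⟨ T ⟩ → ⟨ S ⟩ ⊆ ⟨ T ⟩
  ⟨⟩-⊆ S⊆T = ⟨⟩-ind _ S⊆T one inv mul resp

  generates-⊆ : ∀ {S T : Pred Carrier ℓ} →
                S ⊆ ⟨ T ⟩ → Generates ⟨ S ⟩ → Generates ⟨ T ⟩
  generates-⊆ S⊆T generates x = ⟨⟩-⊆ S⊆T (generates x)

  Commute : Carrier → Carrier → Set ℓ
  Commute x y = x ∙ y ≈ y ∙ x

  commute-refl : ∀ {x} → Commute x x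
  commute-refl = refl

  commute-sym : ∀ {x y} → Commute x y → Commute y x
  commute-sym = sym

  commute-ε : ∀ {x} → Commute x ε
  commute-ε = trans (identityʳ _) (sym (identityˡ _))

  commute-⁻¹ : ∀ {x y} → Commute x y → Commute x (y ⁻¹)
  commute-⁻¹ {x} {y} xy = begin
    x ∙ y ⁻¹                  ≈⟨ solve₂ (X · Y ⁻) ((Y ⁻ · (Y · X)) · Y ⁻) ≡.refl x y ⟩
    (y ⁻¹ ∙ (y ∙ x)) ∙ y ⁻¹   ≈⟨ ∙-congʳ (∙-congˡ xy) ⟨
    (y ⁻¹ ∙ (x ∙ y)) ∙ y ⁻¹   ≈⟨ solve₂ ((Y ⁻ · (X · Y)) · Y ⁻) (Y ⁻ · X) ≡.refl x y ⟩
    y ⁻¹ ∙ x                  ∎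

  commute-∙ : ∀ {x y z} → Commute x y → Commute x z → Commute x (y ∙ z)
  commute-∙ {x} {y} {z} xy xz = begin
    x ∙ (y ∙ z)  ≈⟨ assoc x y z ⟨
    (x ∙ y) ∙ z  ≈⟨ ∙-congʳ xy ⟩
    (y ∙ x) ∙ z  ≈⟨ assoc y x z ⟩
    y ∙ (x ∙ z)  ≈⟨ ∙-congˡ xz ⟩
    y ∙ (z ∙ x)  ≈⟨ assoc y z x ⟨
    (y ∙ z) ∙ x  ∎

  commute-respʳ : ∀ {x y y′} → y ≈ y′ → Commute x y → Commute x y′
  commute-respʳ e xy = trans (∙-congˡ (sym e)) (trans xy (∙-congʳ e))

  commute-respˡ : ∀ {x x′ y} → x ≈ x′ → Commute x y → Commute x′ y
  commute-respˡ e xy = commute-sym (commute-respʳ e (commute-sym xy))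

  commute-resp : ∀ {x x′ y y′} → x ≈ x′ → y ≈ y′ → Commute x y → Commute x′ y′
  commute-resp e f xy = commute-respˡ e (commute-respʳ f xy)

  centralises : ∀ {s} {S : Pred Carrier s} {x} → S ⊆ Commute x → ⟨ S ⟩ ⊆ Commute x
  centralises S⊆C = ⟨⟩-ind _ S⊆C commute-ε commute-⁻¹ commute-∙ commute-respʳ

  ⟨⟩-abelian : ∀ {T : Pred Carrier ℓ} → (∀ {u w} → T u → T w → Commute u w) → Abelian ⟨ T ⟩
  ⟨⟩-abelian T-commute x∈ y∈ =
    centralises (λ {w} w∈ → commute-sym (centralises {x = w} (T-commute w∈) x∈)) y∈

  ^-cong : ∀ {x x′ g g′} → x ≈ x′ → g ≈ g′ → x ^ g ≈ x′ ^ g′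
  ^-cong e f = ∙-cong (∙-cong (⁻¹-cong f) e) f

  [,]-cong : ∀ {x x′ y y′} → x ≈ x′ → y ≈ y′ → [ x , y ] ≈ [ x′ , y′ ]
  [,]-cong e f = ∙-cong (∙-cong (∙-cong (⁻¹-cong e) (⁻¹-cong f)) e) f

  commute⇒^≈ : ∀ {x g} → Commute x g → x ^ g ≈ x
  commute⇒^≈ {x} {g} xg = begin
    (g ⁻¹ ∙ x) ∙ g  ≈⟨ assoc _ _ _ ⟩
    g ⁻¹ ∙ (x ∙ g)  ≈⟨ ∙-congˡ xg ⟩
    g ⁻¹ ∙ (g ∙ x)  ≈⟨ solve₂ (Y ⁻ · (Y · X)) X ≡.refl x g ⟩
    x               ∎

  commute⇒[,]≈ε : ∀ {x y} → Commute x y → [ x , y ] ≈ ε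
  commute⇒[,]≈ε {x} {y} xy = begin
    [ x , y ]              ≈⟨ solve₂ [ X , Y ]ₑ ((Y · X) ⁻ · (X · Y)) ≡.refl x y ⟩
    (y ∙ x) ⁻¹ ∙ (x ∙ y)   ≈⟨ ∙-congˡ xy ⟩
    (y ∙ x) ⁻¹ ∙ (y ∙ x)   ≈⟨ inverseˡ _ ⟩
    ε                      ∎

  [,]≈ε⇒commute : ∀ {x y} → [ x , y ] ≈ ε → Commute x y
  [,]≈ε⇒commute {x} {y} [x,y]≈ε = begin
    x ∙ y                ≈⟨ solve₂ (X · Y) ((Y · X) · [ X , Y ]ₑ) ≡.refl x y ⟩
    (y ∙ x) ∙ [ x , y ]  ≈⟨ ∙-congˡ [x,y]≈ε ⟩
    (y ∙ x) ∙ ε          ≈⟨ identityʳ _ ⟩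
    y ∙ x                ∎

  [,]≈⁻¹∙^ : ∀ x g → [ x , g ] ≈ x ⁻¹ ∙ x ^ g
  [,]≈⁻¹∙^ = solve₂ [ X , Y ]ₑ (X ⁻ · X ^ₑ Y) ≡.refl

  [,]⁻¹ : ∀ x y → [ x , y ] ⁻¹ ≈ [ y , x ]
  [,]⁻¹ = solve₂ ([ X , Y ]ₑ ⁻) [ Y , X ]ₑ ≡.refl

  ⁻¹-^ : ∀ x g → (x ^ g) ⁻¹ ≈ (x ⁻¹) ^ g
  ⁻¹-^ = solve₂ ((X ^ₑ Y) ⁻) ((X ⁻) ^ₑ Y) ≡.refl

  ∙-^ : ∀ x y g → x ^ g ∙ y ^ g ≈ (x ∙ y) ^ g
  ∙-^ = solve₃ (X ^ₑ Z · Y ^ₑ Z) ((X · Y) ^ₑ Z) ≡.refl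

  ^-^ : ∀ x g h → (x ^ g) ^ h ≈ x ^ (g ∙ h)
  ^-^ = solve₃ ((X ^ₑ Y) ^ₑ Z) (X ^ₑ (Y · Z)) ≡.refl

  ^-^⁻¹ : ∀ x g → (x ^ g) ^ (g ⁻¹) ≈ x
  ^-^⁻¹ = solve₂ ((X ^ₑ Y) ^ₑ (Y ⁻)) X ≡.refl

  ^⁻¹-^ : ∀ x g → (x ^ (g ⁻¹)) ^ g ≈ x
  ^⁻¹-^ = solve₂ ((X ^ₑ (Y ⁻)) ^ₑ Y) X ≡.refl

  [,⁻¹] : ∀ x g → ([ x , g ] ^ (g ⁻¹)) ⁻¹ ≈ [ x , g ⁻¹ ]
  [,⁻¹] = solve₂ (([ X , Y ]ₑ ^ₑ (Y ⁻)) ⁻) [ X , Y ⁻ ]ₑ ≡.refl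

  [,∙] : ∀ x g h → [ x , h ] ∙ [ x , g ] ^ h ≈ [ x , g ∙ h ]
  [,∙] = solve₃ ([ X , Z ]ₑ · [ X , Y ]ₑ ^ₑ Z) [ X , Y · Z ]ₑ ≡.refl

  [⁻¹,] : ∀ x g → ([ x , g ] ^ (x ⁻¹)) ⁻¹ ≈ [ x ⁻¹ , g ]
  [⁻¹,] = solve₂ (([ X , Y ]ₑ ^ₑ (X ⁻)) ⁻) [ X ⁻ , Y ]ₑ ≡.refl

  [∙,] : ∀ x y g → [ x , g ] ^ y ∙ [ y , g ] ≈ [ x ∙ y , g ]
  [∙,] = solve₃ ([ X , Z ]ₑ ^ₑ Y · [ Y , Z ]ₑ) [ X · Y , Z ]ₑ ≡.refl

  module _ {T : Pred Carrier ℓ} where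
    commute⇒^∈ : ∀ {u g} → Commute u g → ⟨ T ⟩ u → ⟨ T ⟩ (u ^ g) × ⟨ T ⟩ (u ^ (g ⁻¹))
    commute⇒^∈ ug u∈ = resp (sym (commute⇒^≈ ug)) u∈ , resp (sym (commute⇒^≈ (commute-⁻¹ ug))) u∈

    ^∈⇒[,]∈ : ∀ {u g} → ⟨ T ⟩ u → ⟨ T ⟩ (u ^ g) → ⟨ T ⟩ [ u , g ]
    ^∈⇒[,]∈ {u} {g} u∈ u^g∈ = resp (sym ([,]≈⁻¹∙^ u g)) (mul (inv u∈) u^g∈)

    [,]∈-self : ∀ {x} → ⟨ T ⟩ [ x , x ]
    [,]∈-self = resp (sym (commute⇒[,]≈ε commute-refl)) one

    [,]∈-swap : ∀ {x y} → ⟨ T ⟩ [ x , y ] → ⟨ T ⟩ [ y , x ]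
    [,]∈-swap {x} {y} c = resp ([,]⁻¹ x y) (inv c)

    [,]∈-resp : ∀ {x y g h} → g ≈ x → h ≈ y → ⟨ T ⟩ [ x , y ] → ⟨ T ⟩ [ g , h ]
    [,]∈-resp e f = resp ([,]-cong (sym e) (sym f))

    generator-commutators₂ : ∀ {a b} → ⟨ T ⟩ [ a , b ] →
      ∀ {g h} → (g ≈ a ⊎ g ≈ b) → (h ≈ a ⊎ h ≈ b) → ⟨ T ⟩ [ g , h ]
    generator-commutators₂ c (inj₁ e) (inj₁ f) = [,]∈-resp e f [,]∈-self
    generator-commutators₂ c (inj₁ e) (inj₂ f) = [,]∈-resp e f c
    generator-commutators₂ c (inj₂ e) (inj₁ f) = [,]∈-resp e f ([,]∈-swap c)
    generator-commutators₂ c (inj₂ e) (inj₂ f) = [,]∈-resp e f [,]∈-self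

    generator-commutators₃ : ∀ {a b d} → ⟨ T ⟩ [ a , b ] → ⟨ T ⟩ [ a , d ] → ⟨ T ⟩ [ b , d ] →
      ∀ {g h} → (g ≈ a ⊎ g ≈ b ⊎ g ≈ d) → (h ≈ a ⊎ h ≈ b ⊎ h ≈ d) → ⟨ T ⟩ [ g , h ]
    generator-commutators₃ p q r (inj₁ e)        (inj₁ f)        = [,]∈-resp e f [,]∈-self
    generator-commutators₃ p q r (inj₁ e)        (inj₂ (inj₁ f)) = [,]∈-resp e f p
    generator-commutators₃ p q r (inj₁ e)        (inj₂ (inj₂ f)) = [,]∈-resp e f q
    generator-commutators₃ p q r (inj₂ (inj₁ e)) (inj₁ f)        = [,]∈-resp e f ([,]∈-swap p)
    generator-commutators₃ p q r (inj₂ (inj₁ e)) (inj₂ (inj₁ f)) = [,]∈-resp e f [,]∈-self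
    generator-commutators₃ p q r (inj₂ (inj₁ e)) (inj₂ (inj₂ f)) = [,]∈-resp e f r
    generator-commutators₃ p q r (inj₂ (inj₂ e)) (inj₁ f)        = [,]∈-resp e f ([,]∈-swap q)
    generator-commutators₃ p q r (inj₂ (inj₂ e)) (inj₂ (inj₁ f)) = [,]∈-resp e f ([,]∈-swap r)
    generator-commutators₃ p q r (inj₂ (inj₂ e)) (inj₂ (inj₂ f)) = [,]∈-resp e f [,]∈-self

  module MetabelianCriterion {S T : Pred Carrier ℓ}
    (generates : Generates ⟨ S ⟩)
    (T-commute : ∀ {u w} → T u → T w → Commute u w)
    (T-conj : ∀ {g u} → S g → T u → ⟨ T ⟩ (u ^ g) × ⟨ T ⟩ (u ^ (g ⁻¹)))
    (S-commutator : ∀ {g h} → S g → S h → ⟨ T ⟩ [ g , h ]) where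

    NormalisedBy : Carrier → Set (c ⊔ ℓ)
    NormalisedBy g = ∀ {x} → ⟨ T ⟩ x → ⟨ T ⟩ (x ^ g)

    NormalisedBy± : Carrier → Set (c ⊔ ℓ)
    NormalisedBy± g = NormalisedBy g × NormalisedBy (g ⁻¹)

    normalisedBy-generators : ∀ {g} → (∀ {u} → T u → ⟨ T ⟩ (u ^ g)) → NormalisedBy g
    normalisedBy-generators {g} T^g = ⟨⟩-ind (λ x → ⟨ T ⟩ (x ^ g)) T^g
      (resp (sym (commute⇒^≈ (commute-sym commute-ε))) one)
      (λ {x} x^g∈ → resp (⁻¹-^ x g) (inv x^g∈))
      (λ {x} {y} x^g∈ y^g∈ → resp (∙-^ x y g) (mul x^g∈ y^g∈))
      (λ e → resp (^-cong e refl))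

    normalisedBy±-ε : NormalisedBy± ε
    normalisedBy±-ε = resp (sym (commute⇒^≈ commute-ε)) , resp (sym (commute⇒^≈ (commute-⁻¹ commute-ε)))

    normalisedBy±-⁻¹ : ∀ {g} → NormalisedBy± g → NormalisedBy± (g ⁻¹)
    normalisedBy±-⁻¹ (n , n⁻) = n⁻ , λ x∈ → resp (^-cong refl (sym (⁻¹-involutive _))) (n x∈)

    normalisedBy±-∙ : ∀ {g h} → NormalisedBy± g → NormalisedBy± h → NormalisedBy± (g ∙ h)
    normalisedBy±-∙ {g} {h} (n , n⁻) (m , m⁻) =
        (λ {x} x∈ → resp (^-^ x g h) (m (n x∈)))
      , (λ {x} x∈ → resp (trans (^-^ x (h ⁻¹) (g ⁻¹)) (^-cong refl (sym (⁻¹-anti-homo-∙ g h))))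
                         (n⁻ (m⁻ x∈)))

    normalisedBy±-resp : ∀ {g h} → g ≈ h → NormalisedBy± g → NormalisedBy± h
    normalisedBy±-resp e (n , n⁻) =
      (λ x∈ → resp (^-cong refl e) (n x∈)) , (λ x∈ → resp (^-cong refl (⁻¹-cong e)) (n⁻ x∈))

    normal : ∀ g → NormalisedBy± g
    normal g = ⟨⟩-ind NormalisedBy±
      (λ g∈ → normalisedBy-generators (λ u∈ → proj₁ (T-conj g∈ u∈))
            , normalisedBy-generators (λ u∈ → proj₂ (T-conj g∈ u∈)))
      normalisedBy±-ε normalisedBy±-⁻¹ normalisedBy±-∙ normalisedBy±-resp (generates g)

    [generator,]∈ : ∀ {x} → S x → ∀ g → ⟨ T ⟩ [ x , g ]
    [generator,]∈ {x} x∈ g = ⟨⟩-ind (λ g → ⟨ T ⟩ [ x , g ]) (S-commutator x∈)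
      (resp (sym (commute⇒[,]≈ε commute-ε)) one)
      (λ {g} c → resp ([,⁻¹] x g) (inv (proj₂ (normal g) c)))
      (λ {g} {h} c c′ → resp ([,∙] x g h) (mul c′ (proj₁ (normal h) c)))
      (λ e → resp ([,]-cong refl e))
      (generates g)

    [,]∈ : ∀ x g → ⟨ T ⟩ [ x , g ]
    [,]∈ x = ⟨⟩-ind (λ x → ∀ g → ⟨ T ⟩ [ x , g ]) [generator,]∈
      (λ g → resp (sym (commute⇒[,]≈ε (commute-sym commute-ε))) one)
      (λ {x} c g → resp ([⁻¹,] x g) (inv (proj₂ (normal x) (c g))))
      (λ {x} {y} c c′ g → resp ([∙,] x y g) (mul (proj₁ (normal y) (c g)) (c′ g)))
      (λ e c g → resp ([,]-cong e refl) (c g))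
      (generates x)

    derived⊆⟨T⟩ : Derived ⊆ ⟨ T ⟩
    derived⊆⟨T⟩ = ⟨⟩-⊆ (λ (x , y , e) → resp (sym e) ([,]∈ x y))

    metabelian : Metabelian
    metabelian x∈ y∈ = ⟨⟩-abelian T-commute (derived⊆⟨T⟩ x∈) (derived⊆⟨T⟩ y∈)

  ⟨⟩⊆γ : ∀ n {S : Pred Carrier ℓ} → S ⊆ γ n → ⟨ S ⟩ ⊆ γ n
  ⟨⟩⊆γ zero    S⊆γ _ = tt
  ⟨⟩⊆γ (suc n) S⊆γ   = ⟨⟩-⊆ S⊆γ

  ⊆commutators⇒⊆γ : ∀ {P : Pred Carrier ℓ} →
    (∀ {x} → P x → ∃[ y ] ∃[ g ] (⟨ P ⟩ y × x ≈ [ y , g ])) → ∀ n → P ⊆ γ n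
  ⊆commutators⇒⊆γ P⊆[P,G] zero    _ = tt
  ⊆commutators⇒⊆γ P⊆[P,G] (suc n) x∈ with P⊆[P,G] x∈
  ... | y , g , y∈ , e = gen (y , g , ⟨⟩⊆γ n (⊆commutators⇒⊆γ P⊆[P,G] n) y∈ , e)

  γ₁⊆derived : γ 1 ⊆ Derived
  γ₁⊆derived = ⟨⟩-⊆ (λ (x , g , _ , e) → gen (x , g , e))

  central-derived⇒class≤2 : (∀ {x} → Derived x → ∀ g → Commute x g) → NilpotentClass≤ 2
  central-derived⇒class≤2 central = ⟨⟩-ind (_≈ ε)
    (λ (y , g , y∈ , e) → trans e (commute⇒[,]≈ε (central (γ₁⊆derived y∈) g)))
    refl (λ e → trans (⁻¹-cong e) ε⁻¹≈ε) (λ e f → trans (∙-cong e f) (identityˡ ε)) (λ e f → trans (sym e) f)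

  module SquaringConjugation (d β : Carrier) (d^β≈d² : d ^ β ≈ d ∙ d) where
    root : ℕ → Carrier
    root zero    = d
    root (suc k) = root k ^ (β ⁻¹)

    root-^β : ∀ k → root k ^ β ≈ root k ∙ root k
    root-square : ∀ k → root k ≈ root (suc k) ∙ root (suc k)
    root-^β zero    = d^β≈d²
    root-^β (suc k) = trans (^⁻¹-^ (root k) β) (root-square k)
    root-square k = begin
      root k                       ≈⟨ ^-^⁻¹ (root k) β ⟨
      (root k ^ β) ^ (β ⁻¹)        ≈⟨ ^-cong (root-^β k) refl ⟩
      (root k ∙ root k) ^ (β ⁻¹)   ≈⟨ ∙-^ (root k) (root k) (β ⁻¹) ⟨
      root (suc k) ∙ root (suc k)  ∎

    root-commute-+ : ∀ e j → Commute (root j) (root (e + j))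
    root-commute-+ zero    j = commute-refl
    root-commute-+ (suc e) j =
      commute-sym (commute-respʳ (sym (root-square j)) (commute-∙ ih ih))
      where
      ih : Commute (root (suc e + j)) (root (suc j))
      ih = commute-sym (≡.subst (λ m → Commute (root (suc j)) (root m)) (+-suc e j) (root-commute-+ e (suc j)))

    roots-commute : ∀ j k → Commute (root j) (root k)
    roots-commute j k with ≤-total j k
    ... | inj₁ j≤k = ≡.subst (λ m → Commute (root j) (root m)) (m∸n+n≡m j≤k) (root-commute-+ (k ∸ j) j)
    ... | inj₂ k≤j = commute-sym (≡.subst (λ m → Commute (root k) (root m)) (m∸n+n≡m k≤j) (root-commute-+ (j ∸ k) k))

    Root : Pred Carrier ℓ
    Root x = ∃[ k ] x ≈ root k

    Root-commute : ∀ {u w} → Root u → Root w → Commute u w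
    Root-commute (j , e) (k , f) = commute-resp (sym e) (sym f) (roots-commute j k)

    Root-^β : ∀ {u} → Root u → ⟨ Root ⟩ (u ^ β) × ⟨ Root ⟩ (u ^ (β ⁻¹))
    Root-^β (zero , e) =
        resp (trans (sym d^β≈d²) (^-cong (sym e) refl)) (mul (gen (0 , refl)) (gen (0 , refl)))
      , gen (1 , ^-cong e refl)
    Root-^β (suc k , e) =
        gen (k , trans (^-cong e refl) (^⁻¹-^ (root k) β))
      , gen (suc (suc k) , ^-cong e refl)

    centralises-roots : ∀ {z u} → Commute z d → Commute z β → Root u → Commute u z
    centralises-roots {z} zd zβ (k , e) = commute-sym (commute-respʳ (sym e) (commute-root k))
      where
      zβ⁻¹ : Commute z (β ⁻¹)
      zβ⁻¹ = commute-⁻¹ zβ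
      commute-root : ∀ k → Commute z (root k)
      commute-root zero    = zd
      commute-root (suc k) = commute-∙ (commute-∙ (commute-⁻¹ zβ⁻¹) (commute-root k)) zβ⁻¹

    d≈[d,β] : d ≈ [ d , β ]
    d≈[d,β] = sym (begin
      [ d , β ]        ≈⟨ [,]≈⁻¹∙^ d β ⟩
      d ⁻¹ ∙ d ^ β     ≈⟨ ∙-congˡ d^β≈d² ⟩
      d ⁻¹ ∙ (d ∙ d)   ≈⟨ solve₁ (X ⁻ · (X · X)) X ≡.refl d ⟩
      d                ∎)

  ¬nilpotent : ∀ {x} → ¬ x ≈ ε → (∀ n → γ n x) → ¬ Nilpotent
  ¬nilpotent x≉ε x∈⋂γ (n , γn-trivial) = x≉ε (γn-trivial (x∈⋂γ n))

  central-commutator-case : ∀ {a b} → Generates ⟨ a , b ⟩₂ →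
    [ [ a , b ] , a ] ≈ ε → [ [ a , b ] , b ] ≈ ε → Metabelian × NilpotentClass≤ 2
  central-commutator-case {a} {b} generates [[a,b],a]≈ε [[a,b],b]≈ε =
    metabelian , central-derived⇒class≤2 derived-central
    where
    T : Pred Carrier ℓ
    T = _≈ [ a , b ]

    [a,b]-central : ∀ g → Commute [ a , b ] g
    [a,b]-central g = centralises
      (λ { (inj₁ e) → commute-respʳ (sym e) ([,]≈ε⇒commute [[a,b],a]≈ε)
         ; (inj₂ e) → commute-respʳ (sym e) ([,]≈ε⇒commute [[a,b],b]≈ε) })
      (generates g)

    T-central : ∀ {u} → T u → ∀ g → Commute u g
    T-central e g = commute-respˡ (sym e) ([a,b]-central g)

    open MetabelianCriterion generates
      (λ u∈ _ → T-central u∈ _) (λ _ u∈ → commute⇒^∈ (T-central u∈ _) (gen u∈))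
      (generator-commutators₂ (gen refl))

    derived-central : ∀ {x} → Derived x → ∀ g → Commute x g
    derived-central x∈ g = commute-sym (centralises (λ u∈ → commute-sym (T-central u∈ g)) (derived⊆⟨T⟩ x∈))

  squaring-case : ∀ {a b d} → Generates ⟨ a , b , d ⟩₃ → Commute a b → Commute a d →
    d ^ b ≈ d ∙ d → Metabelian × (∀ n → γ n d)
  squaring-case {a} {b} {d} generates ab ad d^b≈d² =
    metabelian , λ n → ⊆commutators⇒⊆γ (λ e → d , b , gen refl , trans e d≈[d,β]) n refl
    where
    open SquaringConjugation d b d^b≈d²

    d∈ : ⟨ Root ⟩ d
    d∈ = gen (0 , refl)

    Root-conj : ∀ {g u} → (g ≈ a ⊎ g ≈ b ⊎ g ≈ d) → Root u → ⟨ Root ⟩ (u ^ g) × ⟨ Root ⟩ (u ^ (g ⁻¹))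
    Root-conj (inj₁ e)        u∈ = commute⇒^∈ (commute-respʳ (sym e) (centralises-roots ad ab u∈)) (gen u∈)
    Root-conj (inj₂ (inj₁ e)) u∈ =
      resp (^-cong refl (sym e)) (proj₁ (Root-^β u∈)) , resp (^-cong refl (⁻¹-cong (sym e))) (proj₂ (Root-^β u∈))
    Root-conj (inj₂ (inj₂ e)) u∈ = commute⇒^∈ (commute-respʳ (sym e) (Root-commute u∈ (0 , refl))) (gen u∈)

    open MetabelianCriterion generates Root-commute Root-conj
      (generator-commutators₃ (resp (sym (commute⇒[,]≈ε ab)) one) (resp (sym (commute⇒[,]≈ε ad)) one)
        ([,]∈-swap (^∈⇒[,]∈ d∈ (proj₁ (Root-^β (0 , refl))))))

  inverse-squaring-case : ∀ {a b d} → Generates ⟨ a , b , d ⟩₃ → Commute a b → Commute a d →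
    (d ∙ d) ^ b ≈ d → Metabelian × (∀ n → γ n d)
  inverse-squaring-case {a} {b} {d} generates ab ad [d²]^b≈d =
    squaring-case (generates-⊆ b⁻¹-generates generates) (commute-⁻¹ ab) ad d^b⁻¹≈d²
    where
    b⁻¹-generates : (λ z → z ≈ a ⊎ z ≈ b ⊎ z ≈ d) ⊆ ⟨ a , b ⁻¹ , d ⟩₃
    b⁻¹-generates (inj₁ e)        = gen (inj₁ e)
    b⁻¹-generates (inj₂ (inj₁ e)) = resp (trans (⁻¹-involutive b) (sym e)) (inv (gen (inj₂ (inj₁ refl))))
    b⁻¹-generates (inj₂ (inj₂ e)) = gen (inj₂ (inj₂ e))

    d^b⁻¹≈d² : d ^ (b ⁻¹) ≈ d ∙ d
    d^b⁻¹≈d² = trans (^-cong (sym [d²]^b≈d) refl) (^-^⁻¹ (d ∙ d) b)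

  two-generator-squaring-case : ∀ {a b} → Generates ⟨ a , b ⟩₂ →
    a ^ b ≈ a ∙ a → Metabelian × (∀ n → γ n a)
  two-generator-squaring-case {a} {b} generates a^b≈a² =
    squaring-case (generates-⊆ ⊆⟨ε,b,a⟩ generates) (commute-sym commute-ε) (commute-sym commute-ε) a^b≈a²
    where
    ⊆⟨ε,b,a⟩ : (λ z → z ≈ a ⊎ z ≈ b) ⊆ ⟨ ε , b , a ⟩₃
    ⊆⟨ε,b,a⟩ (inj₁ e) = gen (inj₂ (inj₂ e))
    ⊆⟨ε,b,a⟩ (inj₂ e) = gen (inj₂ (inj₁ e))

  fibonacci-case : ∀ {a b} → Generates ⟨ a , b ⟩₂ →
    a ^ (b ∙ b) ≈ a ∙ a ^ b → [ a , a ^ b ] ≈ ε → Metabelian × (∀ n → γ n a)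
  fibonacci-case {a} {b} generates a^b²≈a∙a^b [a,a^b]≈ε =
    metabelian , λ n → ⊆commutators⇒⊆γ T⊆[⟨T⟩,G] n (inj₁ refl)
    where
    y : Carrier
    y = a ^ b

    T : Pred Carrier ℓ
    T z = z ≈ a ⊎ z ≈ y

    a∈ : ⟨ T ⟩ a
    a∈ = gen (inj₁ refl)

    y∈ : ⟨ T ⟩ y
    y∈ = gen (inj₂ refl)

    ay : Commute a y
    ay = [,]≈ε⇒commute [a,a^b]≈ε

    y^b : y ^ b ≈ a ∙ y
    y^b = trans (^-^ a b b) a^b²≈a∙a^b

    a^b⁻¹ : a ^ (b ⁻¹) ≈ y ∙ a ⁻¹
    a^b⁻¹ = begin
      a ^ (b ⁻¹)                               ≈⟨ solve₂ X ((X · Y) · Y ⁻) ≡.refl (a ^ (b ⁻¹)) a ⟩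
      (a ^ (b ⁻¹) ∙ a) ∙ a ⁻¹                  ≈⟨ ∙-congʳ (∙-congˡ (^-^⁻¹ a b)) ⟨
      (a ^ (b ⁻¹) ∙ y ^ (b ⁻¹)) ∙ a ⁻¹         ≈⟨ ∙-congʳ (∙-^ a y (b ⁻¹)) ⟩
      (a ∙ y) ^ (b ⁻¹) ∙ a ⁻¹                  ≈⟨ ∙-congʳ (^-cong y^b refl) ⟨
      (y ^ b) ^ (b ⁻¹) ∙ a ⁻¹                  ≈⟨ ∙-congʳ (^-^⁻¹ y b) ⟩
      y ∙ a ⁻¹                                 ∎

    T-commute : ∀ {u w} → T u → T w → Commute u w
    T-commute (inj₁ e) (inj₁ f) = commute-resp (sym e) (sym f) commute-refl
    T-commute (inj₁ e) (inj₂ f) = commute-resp (sym e) (sym f) ay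
    T-commute (inj₂ e) (inj₁ f) = commute-resp (sym e) (sym f) (commute-sym ay)
    T-commute (inj₂ e) (inj₂ f) = commute-resp (sym e) (sym f) commute-refl

    T-conj : ∀ {g u} → (g ≈ a ⊎ g ≈ b) → T u → ⟨ T ⟩ (u ^ g) × ⟨ T ⟩ (u ^ (g ⁻¹))
    T-conj (inj₁ e) u∈ = commute⇒^∈ (commute-respʳ (sym e) (T-commute u∈ (inj₁ refl))) (gen u∈)
    T-conj (inj₂ e) (inj₁ f) =
        gen (inj₂ (^-cong f e))
      , resp (sym (trans (^-cong f (⁻¹-cong e)) a^b⁻¹)) (mul y∈ (inv a∈))
    T-conj (inj₂ e) (inj₂ f) =
        resp (sym (trans (^-cong f e) y^b)) (mul a∈ y∈)
      , gen (inj₁ (trans (^-cong f (⁻¹-cong e)) (^-^⁻¹ a b)))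

    open MetabelianCriterion generates T-commute T-conj (generator-commutators₂ (^∈⇒[,]∈ a∈ y∈))

    a≈[y,b] : a ≈ [ y , b ]
    a≈[y,b] = sym (begin
      [ y , b ]         ≈⟨ [,]≈⁻¹∙^ y b ⟩
      y ⁻¹ ∙ y ^ b      ≈⟨ ∙-congˡ (trans y^b ay) ⟩
      y ⁻¹ ∙ (y ∙ a)    ≈⟨ solve₂ (Y ⁻ · (Y · X)) X ≡.refl a y ⟩
      a                 ∎)

    y≈[ay,b] : y ≈ [ a ∙ y , b ]
    y≈[ay,b] = sym (begin
      [ a ∙ y , b ]                  ≈⟨ [,]≈⁻¹∙^ (a ∙ y) b ⟩
      (a ∙ y) ⁻¹ ∙ (a ∙ y) ^ b       ≈⟨ ∙-congˡ (∙-^ a y b) ⟨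
      (a ∙ y) ⁻¹ ∙ (y ∙ y ^ b)       ≈⟨ ∙-cong (⁻¹-cong ay) (∙-congˡ y^b) ⟩
      (y ∙ a) ⁻¹ ∙ (y ∙ (a ∙ y))     ≈⟨ solve₂ ((Y · X) ⁻ · (Y · (X · Y))) Y ≡.refl a y ⟩
      y                              ∎)

    T⊆[⟨T⟩,G] : ∀ {x} → T x → ∃[ u ] ∃[ g ] (⟨ T ⟩ u × x ≈ [ u , g ])
    T⊆[⟨T⟩,G] (inj₁ e) = y , b , y∈ , trans e a≈[y,b]
    T⊆[⟨T⟩,G] (inj₂ e) = a ∙ y , b , mul a∈ y∈ , trans e y≈[ay,b]

lemma2p6 : ∀ {c ℓ ℓ₂} (G : OrderedGroup c ℓ ℓ₂) →
    let open GroupNotions (OrderedGroup.group G) in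
    Young → Metabelian × (Nilpotent → NilpotentClass≤ 2)
lemma2p6 G = λ where
    (inj₁ (a , b , generates , [[a,b],a]≈ε , [[a,b],b]≈ε)) →
      let metabelian , class≤2 = central-commutator-case generates [[a,b],a]≈ε [[a,b],b]≈ε
      in metabelian , λ _ → class≤2
    (inj₂ (inj₁ (a , b , d , (generates , ab , ad , _) , inj₁ d^b≈d² , d≉ε))) →
      let metabelian , d∈⋂γ = squaring-case generates ab ad d^b≈d²
      in metabelian , ⊥-elim ∘ ¬nilpotent d≉ε d∈⋂γ
    (inj₂ (inj₁ (a , b , d , (generates , ab , ad , _) , inj₂ [d²]^b≈d , d≉ε))) →
      let metabelian , d∈⋂γ = inverse-squaring-case generates ab ad [d²]^b≈d
      in metabelian , ⊥-elim ∘ ¬nilpotent d≉ε d∈⋂γ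
    (inj₂ (inj₂ (inj₁ (a , b , generates , a^b≈a² , a≉ε)))) →
      let metabelian , a∈⋂γ = two-generator-squaring-case generates a^b≈a²
      in metabelian , ⊥-elim ∘ ¬nilpotent a≉ε a∈⋂γ
    (inj₂ (inj₂ (inj₂ (a , b , generates , a^b²≈a∙a^b , [a,a^b]≈ε , a≉ε)))) →
      let metabelian , a∈⋂γ = fibonacci-case generates a^b²≈a∙a^b [a,a^b]≈ε
      in metabelian , ⊥-elim ∘ ¬nilpotent a≉ε a∈⋂γ
  where open YoungGroups (OrderedGroup.group G)
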